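{- Homeo-topo-bisimulations preserve validity: if $M = \langle S, \sigma, v\rangle$ and $M' = \langle S', \sigma', v'\rangle$ are topological models, $\rightleftarrows_f \subseteq S \times S'$ is a homeo-topo-bisimulation based on a homeomorphism $f : S \to S'$, and $s \rightleftarrows_f s'$, then for every modal formula $\varphi$, $M, s \models \varphi$ if and only if $M', s' \models \varphi$.
   Context: A topological model is $\langle S, \sigma, v\rangle$ with $\sigma$ a topology on $S$ and $v$ a valuation of propositional variables; modal formulae are interpreted with Boolean connectives as usual, $\Box$ as topological interior and $\Diamond$ as topological closure. Given a homeomorphism $f$ from $\langle S,\sigma\rangle$ onto $\langle S',\sigma'\rangle$, a homeo-topo-bisimulation based on $f$ is a nonempty relation $\rightleftarrows_f \subseteq S \times S'$ such that whenever $s \rightleftarrows_f s'$: (Base) $s \in v(p)$ iff $s' \in v'(p)$ for every propositional variable $p$; (Forth) if $s \in U \in \sigma$ then $f(U) \in \sigma'$, $s' \in f(U)$, and for every $t' \in f(U)$ there is $t \in U$ with $t \rightleftarrows_f t'$; (Back) if $s' \in f(U) \in \sigma'$ then there is $U \in \sigma$ with $s \in U$ such that for every $t \in U$ there is $t' \in f(U)$ with $t \rightleftarrows_f t'$. -}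

module Defs where

open import Data.Nat using (ℕ)
open import Data.Product using (Σ; ∃; _×_; _,_)
open import Data.Sum using (_⊎_)
open import Data.Empty using (⊥)
open import Data.Unit using (⊤)
open import Level using (Lift; lift)
open import Data.Empty.Polymorphic renaming (⊥ to ⊥₁)
open import Data.Unit.Polymorphic renaming (⊤ to ⊤₁)
open import Relation.Nullary using (¬_)
open import Relation.Binary.PropositionalEquality using (_≡_)
open import Function.Bundles using (_⇔_)

Subset : Set → Set₁
Subset S = S → Set

record Topology (S : Set) : Set₁ where
  field
    Open      : Subset S → Set
    ext       : ∀ {U V : Subset S} → (∀ x → U x → V x) → (∀ x → V x → U x) →
                Open U → Open V
    open-full : Open (λ _ → ⊤)
    open-∩    : ∀ {U V : Subset S} → Open U → Open V → Open (λ x → U x × V x)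
    open-⋃    : ∀ (I : Set) (U : I → Subset S) → (∀ i → Open (U i)) →
                Open (λ x → Σ I (λ i → U i x))
open Topology public

image : {S S' : Set} → (S → S') → Subset S → Subset S'
image f U y = ∃ λ x → U x × f x ≡ y

preimage : {S S' : Set} → (S → S') → Subset S' → Subset S
preimage f V x = V (f x)

-- A homeomorphism between topological spaces: a bijection (with explicit
-- two-sided inverse) which is continuous and whose inverse is continuous
-- (equivalently: continuous and open).
record IsHomeomorphism {S S' : Set} (σ : Topology S) (σ' : Topology S')
                       (f : S → S') : Set₁ where
  field
    inv        : S' → S
    inv-left   : ∀ x → inv (f x) ≡ x
    inv-right  : ∀ y → f (inv y) ≡ y
    continuous : ∀ (V : Subset S') → Open σ' V → Open σ (preimage f V)
    open-map   : ∀ (U : Subset S) → Open σ U → Open σ' (image f U)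

Var : Set
Var = ℕ

record TopoModel : Set₁ where
  field
    S   : Set
    σ   : Topology S
    val : Var → Subset S
open TopoModel public

data Form : Set where
  var  : Var → Form
  ⊥'   : Form
  ⊤'   : Form
  ¬'_  : Form → Form
  _∧'_ : Form → Form → Form
  _∨'_ : Form → Form → Form
  _⇒'_ : Form → Form → Form
  □_   : Form → Form
  ◇_   : Form → Form

-- Satisfaction: □ is interior, ◇ is closure.
-- (Set₁-valued since □ quantifies over subsets.)
_,_⊨_ : (M : TopoModel) → S M → Form → Set₁
M , s ⊨ var p    = Lift _ (val M p s)
M , s ⊨ ⊥'       = ⊥₁
M , s ⊨ ⊤'       = ⊤₁
M , s ⊨ (¬' φ)   = ¬ (M , s ⊨ φ)
M , s ⊨ (φ ∧' ψ) = (M , s ⊨ φ) × (M , s ⊨ ψ)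
M , s ⊨ (φ ∨' ψ) = (M , s ⊨ φ) ⊎ (M , s ⊨ ψ)
M , s ⊨ (φ ⇒' ψ) = (M , s ⊨ φ) → (M , s ⊨ ψ)
M , s ⊨ (□ φ)    = ∃ λ (U : Subset (S M)) →
                     Open (σ M) U × U s × (∀ t → U t → M , t ⊨ φ)
M , s ⊨ (◇ φ)    = ∀ (U : Subset (S M)) → Open (σ M) U → U s →
                     ∃ λ t → U t × (M , t ⊨ φ)

record IsHomeoTopoBisim (M M' : TopoModel) (f : S M → S M')
                        (R : S M → S M' → Set) : Set₁ where
  field
    nonempty : ∃ λ s → ∃ λ s' → R s s'
    base     : ∀ {s s'} → R s s' → ∀ p → val M p s ⇔ val M' p s'
    forth    : ∀ {s s'} → R s s' → ∀ (U : Subset (S M)) → U s → Open (σ M) U →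
               Open (σ M') (image f U) × image f U s' ×
               (∀ t' → image f U t' → ∃ λ t → U t × R t t')
    back     : ∀ {s s'} → R s s' → ∀ (U : Subset (S M)) →
               image f U s' → Open (σ M') (image f U) →
               Open (σ M) U × U s ×
               (∀ t → U t → ∃ λ t' → image f U t' × R t t')

{-# OPTIONS --safe #-}
module Submission where

-- Forth transports an open neighbourhood U of s to
-- the open neighbourhood f(U) of s', and Back transports an open neighbourhood
-- V of s' to the open neighbourhood f⁻¹(V) of s; this is where f being a
-- homeomorphism enters, since f(f⁻¹(V)) = V. Every point of either
-- neighbourhood is related to a point of the other, so the induction
-- hypothesis applies pointwise.

open import Defs
open import Data.Product using (∃; _×_; _,_)
open import Data.Product.Function.NonDependent.Propositional using (_×-⇔_)
open import Data.Sum.Function.Propositional using (_⊎-⇔_)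
open import Function.Bundles using (_⇔_; mk⇔; Equivalence)
open import Function.Construct.Identity using (⇔-id)
open import Function.Related.TypeIsomorphisms using (→-cong-⇔; ¬-cong-⇔)
open import Level using (lift; lower)
open import Relation.Binary.PropositionalEquality using (_≡_; refl; subst; sym)

open Equivalence using (to; from)

image-preimage⁻ : {S S' : Set} (f : S → S') (V : Subset S') →
                  ∀ {y} → image f (preimage f V) y → V y
image-preimage⁻ f V (x , Vfx , refl) = Vfx

image-preimage⁺ : {S S' : Set} (f : S → S') (g : S' → S) → (∀ y → f (g y) ≡ y) →
                  (V : Subset S') → ∀ {y} → V y → image f (preimage f V) y
image-preimage⁺ f g fg≗id V {y} Vy = g y , subst V (sym (fg≗id y)) Vy , fg≗id y

module _ {S S' : Set} {σ : Topology S} {σ' : Topology S'} {f : S → S'}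
         (hom : IsHomeomorphism σ σ' f) where
  open IsHomeomorphism hom

  image-preimage-open : ∀ V → Open σ' V → Open σ' (image f (preimage f V))
  image-preimage-open V V-open = open-map (preimage f V) (continuous V V-open)

module Bisimulation (M M' : TopoModel) (f : S M → S M')
                    (hom : IsHomeomorphism (σ M) (σ M') f)
                    (R : S M → S M' → Set) (bisim : IsHomeoTopoBisim M M' f R) where
  open IsHomeomorphism hom using (inv; inv-right)
  open IsHomeoTopoBisim bisim

  Invariant : Form → Set₁
  Invariant φ = ∀ {s s'} → R s s' → (M , s ⊨ φ) ⇔ (M' , s' ⊨ φ)

  back-preimage : ∀ {s s'} → R s s' → ∀ V → Open (σ M') V → V s' →
                  Open (σ M) (preimage f V) × preimage f V s ×
                  (∀ t → preimage f V t → ∃ λ t' → V t' × R t t')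
  back-preimage r V V-open Vs'
    with back r (preimage f V) (image-preimage⁺ f inv inv-right V Vs')
                (image-preimage-open hom V V-open)
  ... | U-open , Us , related = U-open , Us , λ t Ut →
    let t' , t'∈fU , rtt' = related t Ut in t' , image-preimage⁻ f V t'∈fU , rtt'

  □-invariant : ∀ {φ} → Invariant φ → Invariant (□ φ)
  □-invariant {φ} ih {s} {s'} r = mk⇔ □-to □-from
    where
    □-to : M , s ⊨ (□ φ) → M' , s' ⊨ (□ φ)
    □-to (U , U-open , Us , U⊨φ) =
      let fU-open , fUs' , related = forth r U Us U-open
      in image f U , fU-open , fUs' , λ t' t'∈fU →
           let t , Ut , rtt' = related t' t'∈fU in to (ih rtt') (U⊨φ t Ut)

    □-from : M' , s' ⊨ (□ φ) → M , s ⊨ (□ φ)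
    □-from (V , V-open , Vs' , V⊨φ) =
      let U-open , Us , related = back-preimage r V V-open Vs'
      in preimage f V , U-open , Us , λ t Ut →
           let t' , Vt' , rtt' = related t Ut in from (ih rtt') (V⊨φ t' Vt')

  ◇-invariant : ∀ {φ} → Invariant φ → Invariant (◇ φ)
  ◇-invariant {φ} ih {s} {s'} r = mk⇔ ◇-to ◇-from
    where
    ◇-to : M , s ⊨ (◇ φ) → M' , s' ⊨ (◇ φ)
    ◇-to meets V V-open Vs' =
      let U-open , Us , related = back-preimage r V V-open Vs'
          t , Ut , t⊨φ = meets (preimage f V) U-open Us
          t' , Vt' , rtt' = related t Ut
      in t' , Vt' , to (ih rtt') t⊨φ

    ◇-from : M' , s' ⊨ (◇ φ) → M , s ⊨ (◇ φ)
    ◇-from meets U U-open Us =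
      let fU-open , fUs' , related = forth r U Us U-open
          t' , t'∈fU , t'⊨φ = meets (image f U) fU-open fUs'
          t , Ut , rtt' = related t' t'∈fU
      in t , Ut , from (ih rtt') t'⊨φ

  invariant : ∀ φ → Invariant φ
  invariant (var p) r = mk⇔ (λ x → lift (to (base r p) (lower x)))
                            (λ x → lift (from (base r p) (lower x)))
  invariant ⊥'       r = ⇔-id _
  invariant ⊤'       r = ⇔-id _
  invariant (¬' φ)   r = ¬-cong-⇔ (invariant φ r)
  invariant (φ ∧' ψ) r = invariant φ r ×-⇔ invariant ψ r
  invariant (φ ∨' ψ) r = invariant φ r ⊎-⇔ invariant ψ r
  invariant (φ ⇒' ψ) r = →-cong-⇔ (invariant φ r) (invariant ψ r)
  invariant (□ φ)    r = □-invariant (invariant φ) r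
  invariant (◇ φ)    r = ◇-invariant (invariant φ) r

theorem3p3 : (M M' : TopoModel) (f : S M → S M') → IsHomeomorphism (σ M) (σ M') f →
    (R : S M → S M' → Set) → IsHomeoTopoBisim M M' f R →
    ∀ {s s'} → R s s' → ∀ (φ : Form) → (M , s ⊨ φ) ⇔ (M' , s' ⊨ φ)
theorem3p3 M M' f hom R bisim r φ = Bisimulation.invariant M M' f hom R bisim φ r
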